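{- Let $\mathcal{K}=(Q,\delta,\lambda)$ be a Kripke structure of degree $k$, let $(S^+,S^-)$ be a sample of $\mathcal{K}$, and let $c=\mathcal{C}_\mathcal{K}(S^+,S^-)$. If $k\ge2$ then $|\mathcal{S}_\mathcal{K}(S^+,S^-)|\le(5\cdot k^c+1)\cdot|S^+|\cdot|S^-|$; if $k=1$ then $|\mathcal{S}_\mathcal{K}(S^+,S^-)|\le(2\cdot c+3)\cdot|S^+|\cdot|S^-|$.
   Context: A Kripke structure is $\mathcal{K}=(Q,\delta,\lambda)$ with $Q$ finite, $\delta:Q\to2^Q\setminus\{\emptyset\}$, $\lambda:Q\to2^{\mathsf{AP}}$ for a finite set $\mathsf{AP}$; both $\mathsf{AP}$ and $Q$ are assumed totally ordered. Its degree is $\max_{q\in Q}|\delta(q)|$. Define equivalences $\sim_i$ on $Q$: $q_1\sim_0q_2$ iff $\lambda(q_1)=\lambda(q_2)$; $q_1\sim_{i+1}q_2$ iff $q_1\sim_iq_2$ and $\{[q_1']_{\sim_i}\mid q_1'\in\delta(q_1)\}=\{[q_2']_{\sim_i}\mid q_2'\in\delta(q_2)\}$. The bisimulation $\sim$ is the coarsest equivalence such that $q_1\sim q_2$ implies $\lambda(q_1)=\lambda(q_2)$ and every successor of $q_1$ is $\sim$-related to some successor of $q_2$. A sample is a pair $(S^+,S^-)$ of subsets of $Q$ with $q^+\not\sim q^-$ for all $q^+\in S^+,q^-\in S^-$. For such $A,B\subseteq Q$, $\mathcal{C}_\mathcal{K}(A,B)$ is the smallest $c\in\mathbb{N}$ with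 $a\not\sim_c b$ for all $a\in A,b\in B$. For $q_1\not\sim q_2$, with $c'=\mathcal{C}_\mathcal{K}(\{q_1\},\{q_2\})$, the formula $D_{q_1,q_2}$ is defined inductively on $c'$: if $c'=0$ and $\lambda(q_1)\setminus\lambda(q_2)\neq\emptyset$ with minimal element $a$, $D_{q_1,q_2}=a$; else if $c'=0$ and $\lambda(q_2)\setminus\lambda(q_1)\ne\emptyset$ with minimal element $a$, $D_{q_1,q_2}=\neg a$; else if $c'\neq0$ and some $q_1'\in\delta(q_1)$ satisfies $q_1'\not\sim_{c'-1}q_2'$ for all $q_2'\in\delta(q_2)$, then, with the smallest such $q_1'$, $D_{q_1,q_2}=\exists\mathsf{X}\bigl(\bigwedge_{q_2'\in\delta(q_2)}D_{q_1',q_2'}\bigr)$; else if $c'\ne0$ and some $q_2'\in\delta(q_2)$ satisfies $q_1'\not\sim_{c'-1}q_2'$ for all $q_1'\in\delta(q_1)$, then, with the smallest such $q_2'$, $D_{q_1,q_2}=\forall\mathsf{X}\,\neg\bigl(\bigwedge_{q_1'\in\delta(q_1)}D_{q_2',q_1'}\bigr)$. The separating formula is $\mathcal{S}_\mathcal{K}(S^+,S^-)=\bigvee_{q^+\in S^+}\bigwedge_{q^-\in S^- }D_{q^+,q^- }$. The size $|\varphi|$ of a formula is the number of nodes of its smallest syntactic DAG (its syntax tree with identical subtrees coalesced). -}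

module Defs where

open import Data.Nat using (ℕ; zero; suc; _⊔_)
open import Data.Bool using (Bool; true; false; _∧_; _∨_; not; T)
open import Data.Fin using (Fin)
import Data.Fin as F
open import Data.Fin.Subset using (Subset; Nonempty; _─_; ∣_∣)
open import Data.Vec using (lookup)
open import Data.List using (List; []; _∷_; map; foldr; allFin; filterᵇ; findᵇ; length)
open import Data.Bool.ListAction using (all; any)
open import Data.Maybe using (Maybe; just; nothing)
open import Data.Product using (_×_; Σ; ∃)
open import Relation.Nullary using (¬_; ⌊_⌋)
open import Relation.Binary.PropositionalEquality using (_≡_)
open import Relation.Binary.Structures using (IsEquivalence)

-- Kripke structures.  Q = Fin n, AP = Fin m (both totally ordered by
-- the usual order on Fin).  Subsets are Data.Fin.Subset.

record Kripke (n m : ℕ) : Set where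
  field
    δ        : Fin n → Subset n
    δ-nonemp : ∀ q → Nonempty (δ q)
    lab      : Fin n → Subset m
open Kripke public

elems : ∀ {n} → Subset n → List (Fin n)
elems {n} p = filterᵇ (lookup p) (allFin n)

degree : ∀ {n m} → Kripke n m → ℕ
degree {n} K = foldr _⊔_ 0 (map (λ q → ∣ δ K q ∣) (allFin n))

eqSub : ∀ {n} → Subset n → Subset n → Bool
eqSub {n} p r = all (λ a → ⌊ lookup p a Data.Bool.≟ lookup r a ⌋) (allFin n)
  where import Data.Bool

-- The equivalences ~_i (Boolean-valued; unfolding of the definition:
-- the sets of ~_i-classes of successors are equal iff every successor of
-- one is ~_i to some successor of the other and vice versa).

simᵇ : ∀ {n m} → Kripke n m → ℕ → Fin n → Fin n → Bool
simᵇ K zero    q₁ q₂ = eqSub (lab K q₁) (lab K q₂)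
simᵇ K (suc i) q₁ q₂ =
  simᵇ K i q₁ q₂
  ∧ all (λ q₁' → any (λ q₂' → simᵇ K i q₁' q₂') (elems (δ K q₂))) (elems (δ K q₁))
  ∧ all (λ q₂' → any (λ q₁' → simᵇ K i q₁' q₂') (elems (δ K q₁))) (elems (δ K q₂))

_⊢_∼[_]_ : ∀ {n m} → Kripke n m → Fin n → ℕ → Fin n → Set
K ⊢ q₁ ∼[ i ] q₂ = T (simᵇ K i q₁ q₂)

IsBisim : ∀ {n m} → Kripke n m → (Fin n → Fin n → Set) → Set
IsBisim {n} K R =
  ∀ q₁ q₂ → R q₁ q₂ →
    (lab K q₁ ≡ lab K q₂) ×
    (∀ q₁' → q₁' Data.Fin.Subset.∈ δ K q₁ →
       ∃ λ q₂' → q₂' Data.Fin.Subset.∈ δ K q₂ × R q₁' q₂')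
  where import Data.Fin.Subset

_⊢_∼_ : ∀ {n m} → Kripke n m → Fin n → Fin n → Set₁
_⊢_∼_ {n} K q₁ q₂ =
  Σ (Fin n → Fin n → Set) λ R → IsEquivalence R × IsBisim K R × R q₁ q₂

IsSample : ∀ {n m} → Kripke n m → Subset n → Subset n → Set₁
IsSample K S⁺ S⁻ =
  ∀ p q → p Data.Fin.Subset.∈ S⁺ → q Data.Fin.Subset.∈ S⁻ → ¬ (K ⊢ p ∼ q)
  where import Data.Fin.Subset

SepAt : ∀ {n m} → Kripke n m → Subset n → Subset n → ℕ → Set
SepAt K A B c =
  ∀ a b → a Data.Fin.Subset.∈ A → b Data.Fin.Subset.∈ B → ¬ (K ⊢ a ∼[ c ] b)
  where import Data.Fin.Subset

IsC : ∀ {n m} → Kripke n m → Subset n → Subset n → ℕ → Set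
IsC K A B c = SepAt K A B c × (∀ c' → c' Data.Nat.< c → ¬ SepAt K A B c')
  where import Data.Nat

-- C_K({q₁},{q₂}) computed by search: the least c ≤ n with q₁ ≁_c q₂
-- (if q₁ ≁ q₂ this exists since ~_i stabilises after |Q| = n steps;
-- the fallback value n only matters for bisimilar pairs, where D is not used).
C₁ : ∀ {n m} → Kripke n m → Fin n → Fin n → ℕ
C₁ {n} K q₁ q₂ = go n 0
  where
  go : ℕ → ℕ → ℕ
  go zero    c = c
  go (suc f) c with simᵇ K c q₁ q₂
  ... | false = c
  ... | true  = go f (suc c)

-- Formulas (binary connectives; ⊤/⊥ only as empty conjunction/disjunction)

data Form (m : ℕ) : Set where
  tt ff : Form m
  atom  : Fin m → Form m
  neg   : Form m → Form m
  _and_ _or_ : Form m → Form m → Form m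
  EX AX : Form m → Form m

⋀ : ∀ {m} → List (Form m) → Form m
⋀ []           = tt
⋀ (φ ∷ [])     = φ
⋀ (φ ∷ ψ ∷ φs) = φ and ⋀ (ψ ∷ φs)

⋁ : ∀ {m} → List (Form m) → Form m
⋁ []           = ff
⋁ (φ ∷ [])     = φ
⋁ (φ ∷ ψ ∷ φs) = φ or ⋁ (ψ ∷ φs)

minElem : ∀ {m} → Subset m → Maybe (Fin m)
minElem p = findᵇ (lookup p) (allFin _)

-- D_{q₁,q₂}, by recursion on a fuel argument (≥ C+1 suffices since the
-- recursive calls have strictly smaller C); unreachable cases return tt.
Dfuel : ∀ {n m} → Kripke n m → ℕ → Fin n → Fin n → Form m
Dfuel K zero q₁ q₂ = tt
Dfuel K (suc f) q₁ q₂ = body (C₁ K q₁ q₂)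
  where
  body : ℕ → Form _
  body zero with minElem (lab K q₁ ─ lab K q₂)
  ... | just a  = atom a
  ... | nothing with minElem (lab K q₂ ─ lab K q₁)
  ...   | just a  = neg (atom a)
  ...   | nothing = tt
  body (suc c) with findᵇ (λ q₁' → all (λ q₂' → not (simᵇ K c q₁' q₂')) (elems (δ K q₂)))
                          (elems (δ K q₁))
  ... | just q₁' = EX (⋀ (map (λ q₂' → Dfuel K f q₁' q₂') (elems (δ K q₂))))
  ... | nothing with findᵇ (λ q₂' → all (λ q₁' → not (simᵇ K c q₁' q₂')) (elems (δ K q₁)))
                           (elems (δ K q₂))
  ...   | just q₂' = AX (neg (⋀ (map (λ q₁' → Dfuel K f q₂' q₁') (elems (δ K q₁)))))
  ...   | nothing  = tt

D : ∀ {n m} → Kripke n m → Fin n → Fin n → Form m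
D K q₁ q₂ = Dfuel K (suc (C₁ K q₁ q₂)) q₁ q₂

Sep : ∀ {n m} → Kripke n m → Subset n → Subset n → Form m
Sep K S⁺ S⁻ = ⋁ (map (λ p → ⋀ (map (λ q → D K p q) (elems S⁻))) (elems S⁺))

-- Size = number of nodes of the smallest DAG = number of distinct subformulas

eqF : ∀ {m} → Form m → Form m → Bool
eqF tt tt = true
eqF ff ff = true
eqF (atom a) (atom b) = ⌊ a F.≟ b ⌋
eqF (neg φ) (neg ψ) = eqF φ ψ
eqF (φ₁ and φ₂) (ψ₁ and ψ₂) = eqF φ₁ ψ₁ ∧ eqF φ₂ ψ₂
eqF (φ₁ or φ₂) (ψ₁ or ψ₂) = eqF φ₁ ψ₁ ∧ eqF φ₂ ψ₂
eqF (EX φ) (EX ψ) = eqF φ ψ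
eqF (AX φ) (AX ψ) = eqF φ ψ
eqF _ _ = false

subs : ∀ {m} → Form m → List (Form m)
subs tt = tt ∷ []
subs ff = ff ∷ []
subs (atom a) = atom a ∷ []
subs (neg φ) = neg φ ∷ subs φ
subs (φ and ψ) = (φ and ψ) ∷ subs φ Data.List.++ subs ψ
  where import Data.List
subs (φ or ψ) = (φ or ψ) ∷ subs φ Data.List.++ subs ψ
  where import Data.List
subs (EX φ) = EX φ ∷ subs φ
subs (AX φ) = AX φ ∷ subs φ

dedup : ∀ {m} → List (Form m) → List (Form m)
dedup [] = []
dedup (φ ∷ φs) with any (eqF φ) φs
... | true  = dedup φs
... | false = φ ∷ dedup φs

size : ∀ {m} → Form m → ℕ
size φ = length (dedup (subs φ))

-- The DAG size of a formula is at most its syntax-tree size, so it suffices to count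
-- tree nodes.  If C(q₁,q₂) = c' + 1 ≤ c, then D_{q₁,q₂} is ∃X or ∀X¬ applied to a
-- conjunction of at most k formulas D_{q₁',q₂'} with q₁' ≁_{c'} q₂', hence C(q₁',q₂') ≤ c';
-- so by induction D_{q₁,q₂} has at most sizeBound k c nodes, where sizeBound k 0 = 2 and
-- sizeBound k (c + 1) = 1 + k (sizeBound k c + 1).  A right-nested conjunction or
-- disjunction of L formulas of fewer than M nodes each has fewer than L M nodes, so S has
-- fewer than |S⁺| |S⁻| (sizeBound k c + 1) nodes.  Finally sizeBound 1 c = 2c + 2, and
-- sizeBound k c + 3 ≤ 5 k^c when k ≥ 2.
module Submission where

open import Defs
open import Data.Nat using (ℕ; _≤_; _*_; _+_; _^_)
open import Data.Fin.Subset using (Subset; Nonempty; ∣_∣)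
open import Data.Product using (_×_)
open import Relation.Binary.PropositionalEquality using (_≡_)

open import Data.Bool using (Bool; true; false; not; T; _∧_; _≟_)
open import Data.Bool.ListAction using (all; any) renaming (and to andᵇ; or to orᵇ)
open import Data.Bool.Properties using (∧-comm; T-≡)
open import Data.Fin using (Fin)
import Data.Fin as Fin
open import Data.Fin.Subset using (_∈_; ⁅_⁆; _─_)
open import Data.Fin.Subset.Properties using (p⊆q⇒∣p∣≤∣q∣; ∣⁅x⁆∣≡1; x∈⁅y⁆⇒x≡y)
open import Data.List using (List; []; _∷_; _++_; length; map; foldr; filterᵇ; findᵇ; allFin; tabulate)
open import Data.List.Properties using (length-++; map-cong)
open import Data.List.Membership.Propositional using () renaming (_∈_ to _∈ₗ_)
open import Data.List.Membership.Propositional.Properties using (∈-allFin; ∈-map⁺)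
open import Data.List.Relation.Unary.All as All using (All; []; _∷_)
open import Data.List.Relation.Unary.All.Properties using (all⁺; all-filter)
open import Data.List.Relation.Unary.Any using (here; there)
open import Data.Maybe using (just; nothing)
open import Data.Nat using (zero; suc; _<_; _⊔_; z≤n; s≤s)
open import Data.Nat.Properties hiding (_≟_)
open import Data.Nat.Tactic.RingSolver using (solve-∀)
open import Data.Product using (_,_)
import Data.Vec as Vec
open import Data.Vec.Properties using (lookup⇒[]=)
open import Function using (_∘_; id)
open import Function.Bundles using (Equivalence)
open import Relation.Binary.PropositionalEquality using (refl; sym; trans; cong; cong₂; subst; module ≡-Reasoning)
open import Relation.Nullary using (¬_; ⌊_⌋)
open import Relation.Nullary.Decidable using (T?)

treeSize : ∀ {m} → Form m → ℕ
treeSize φ = length (subs φ)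

length-dedup-≤ : ∀ {m} (φs : List (Form m)) → length (dedup φs) ≤ length φs
length-dedup-≤ [] = z≤n
length-dedup-≤ (φ ∷ φs) with any (eqF φ) φs
... | true  = m≤n⇒m≤1+n (length-dedup-≤ φs)
... | false = s≤s (length-dedup-≤ φs)

size≤treeSize : ∀ {m} (φ : Form m) → size φ ≤ treeSize φ
size≤treeSize φ = length-dedup-≤ (subs φ)

suc-length-++-< : ∀ {A : Set} {M L} (xs ys : List A) →
  length xs < M → length ys < L → suc (length (xs ++ ys)) < M + L
suc-length-++-< {M = M} {L} xs ys xs<M ys<L = begin-strict
  suc (length (xs ++ ys))             ≡⟨ cong suc (length-++ xs) ⟩
  suc (length xs + length ys)         <⟨ s≤s (≤-reflexive (sym (+-suc (length xs) (length ys)))) ⟩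
  suc (length xs) + suc (length ys)   ≤⟨ +-mono-≤ xs<M ys<L ⟩
  M + L                               ∎
  where open ≤-Reasoning

treeSize-⋀-map : ∀ {A : Set} {m M} (g : A → Form m) (xs : List A) → 0 < length xs →
  All (λ x → treeSize (g x) < M) xs → treeSize (⋀ (map g xs)) < length xs * M
treeSize-⋀-map g (x ∷ []) _ (gx<M ∷ []) = subst (treeSize (g x) <_) (sym (+-identityʳ _)) gx<M
treeSize-⋀-map g (x ∷ y ∷ xs) _ (gx<M ∷ rest) =
  suc-length-++-< (subs (g x)) _ gx<M (treeSize-⋀-map g (y ∷ xs) (s≤s z≤n) rest)

treeSize-⋁-map : ∀ {A : Set} {m M} (g : A → Form m) (xs : List A) → 0 < length xs →
  All (λ x → treeSize (g x) < M) xs → treeSize (⋁ (map g xs)) < length xs * M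
treeSize-⋁-map g (x ∷ []) _ (gx<M ∷ []) = subst (treeSize (g x) <_) (sym (+-identityʳ _)) gx<M
treeSize-⋁-map g (x ∷ y ∷ xs) _ (gx<M ∷ rest) =
  suc-length-++-< (subs (g x)) _ gx<M (treeSize-⋁-map g (y ∷ xs) (s≤s z≤n) rest)

length-filterᵇ-tabulate : ∀ {A : Set} {n} (p : Subset n) (P : A → Bool) (f : Fin n → A) →
  (∀ i → P (f i) ≡ Vec.lookup p i) → length (filterᵇ P (tabulate f)) ≡ ∣ p ∣
length-filterᵇ-tabulate Vec.[] P f P∘f≗p = refl
length-filterᵇ-tabulate (b Vec.∷ p) P f P∘f≗p with P (f Fin.zero) | P∘f≗p Fin.zero
... | true  | refl = cong suc (length-filterᵇ-tabulate p P (f ∘ Fin.suc) (P∘f≗p ∘ Fin.suc))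
... | false | refl = length-filterᵇ-tabulate p P (f ∘ Fin.suc) (P∘f≗p ∘ Fin.suc)

length-elems : ∀ {n} (p : Subset n) → length (elems p) ≡ ∣ p ∣
length-elems p = length-filterᵇ-tabulate p (Vec.lookup p) id (λ _ → refl)

elems⊆ : ∀ {n} (p : Subset n) → All (_∈ p) (elems p)
elems⊆ {n} p = All.map (λ {x} px → lookup⇒[]= x p (Equivalence.to T-≡ px))
                       (all-filter (T? ∘ Vec.lookup p) (allFin n))

Nonempty⇒0<∣p∣ : ∀ {n} {p : Subset n} → Nonempty p → 0 < ∣ p ∣
Nonempty⇒0<∣p∣ {p = p} (x , x∈p) = begin
  1           ≡⟨ sym (∣⁅x⁆∣≡1 x) ⟩
  ∣ ⁅ x ⁆ ∣   ≤⟨ p⊆q⇒∣p∣≤∣q∣ (λ y∈⁅x⁆ → subst (_∈ p) (sym (x∈⁅y⁆⇒x≡y x y∈⁅x⁆)) x∈p) ⟩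
  ∣ p ∣       ∎
  where open ≤-Reasoning

0<length-elems : ∀ {n} {p : Subset n} → Nonempty p → 0 < length (elems p)
0<length-elems {p = p} ne = subst (0 <_) (sym (length-elems p)) (Nonempty⇒0<∣p∣ ne)

∈⇒≤foldr-⊔ : ∀ {x xs} → x ∈ₗ xs → x ≤ foldr _⊔_ 0 xs
∈⇒≤foldr-⊔ {xs = x ∷ xs} (here refl) = m≤m⊔n x _
∈⇒≤foldr-⊔ {xs = y ∷ xs} (there x∈xs) = ≤-trans (∈⇒≤foldr-⊔ x∈xs) (m≤n⊔m y _)

∣δ∣≤degree : ∀ {n m} (K : Kripke n m) q → ∣ δ K q ∣ ≤ degree K
∣δ∣≤degree K q = ∈⇒≤foldr-⊔ (∈-map⁺ (λ q → ∣ δ K q ∣) (∈-allFin q))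

findᵇ-just⇒T : ∀ {A : Set} (P : A → Bool) xs {x} → findᵇ P xs ≡ just x → T (P x)
findᵇ-just⇒T P (y ∷ ys) found with P y in Py
findᵇ-just⇒T P (y ∷ ys) refl | true = Equivalence.from T-≡ Py
... | false = findᵇ-just⇒T P ys found

findᵇ-all-just⇒All : ∀ {A B : Set} (P : A → B → Bool) xs ys {x} →
  findᵇ (λ x → all (P x) ys) xs ≡ just x → All (T ∘ P x) ys
findᵇ-all-just⇒All P xs ys found = all⁺ (P _) ys (findᵇ-just⇒T _ xs found)

T-not⇒¬T : ∀ {b} → T (not b) → ¬ T b
T-not⇒¬T {false} _ ()

≟-sym : ∀ (x y : Bool) → ⌊ x ≟ y ⌋ ≡ ⌊ y ≟ x ⌋
≟-sym false false = refl
≟-sym false true  = refl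
≟-sym true  false = refl
≟-sym true  true  = refl

successors : ∀ {n m} → Kripke n m → Fin n → List (Fin n)
successors K q = elems (δ K q)

simᵇ-sym : ∀ {n m} (K : Kripke n m) i q₁ q₂ → simᵇ K i q₁ q₂ ≡ simᵇ K i q₂ q₁
simᵇ-sym {m = m} K zero q₁ q₂ =
  cong andᵇ (map-cong (λ a → ≟-sym (Vec.lookup (lab K q₁) a) (Vec.lookup (lab K q₂) a)) (allFin m))
simᵇ-sym {n} K (suc i) q₁ q₂ =
  cong₂ _∧_ (simᵇ-sym K i q₁ q₂)
    (trans (∧-comm (forth q₁ q₂) (back q₁ q₂))
           (cong₂ _∧_ (back≡forth q₁ q₂) (sym (back≡forth q₂ q₁))))
  where
  forth back : Fin n → Fin n → Bool
  forth q q' = all (λ p → any (λ p' → simᵇ K i p p') (successors K q')) (successors K q)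
  back  q q' = all (λ p' → any (λ p → simᵇ K i p p') (successors K q)) (successors K q')

  back≡forth : ∀ q q' → back q q' ≡ forth q' q
  back≡forth q q' = cong andᵇ (map-cong (λ p' → cong orᵇ
    (map-cong (λ p → simᵇ-sym K i p p') (successors K q))) (successors K q'))

-- The search loop `go` of `C₁` is local to a `where` block and cannot be
-- named, so `C₁-loop` is defined as a metavariable which the otherwise
-- trivial `C₁-loop-solution` forces to be `go` (the `with`s make the
-- arguments of `go` distinct variables, so that unification applies).
mutual
  C₁-loop : ∀ {n m} → Kripke n m → Fin n → Fin n → ℕ → ℕ → ℕ
  C₁-loop = _

  private
    C₁-loop-solution : ∀ {n m} (K : Kripke n m) q₁ q₂ → C₁ K q₁ q₂ ≡ C₁ K q₁ q₂
    C₁-loop-solution {zero} K () q₂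
    C₁-loop-solution {suc n} K q₁ q₂ with simᵇ K 0 q₁ q₂
    ... | false = refl
    ... | true with n | 1
    ... | f | c with suc f
    ... | _ = refl {x = C₁-loop K q₁ q₂ f c}

C₁-loop-≤ : ∀ {n m} (K : Kripke n m) {q₁ q₂ c} → ¬ K ⊢ q₁ ∼[ c ] q₂ →
  ∀ f {c₀} → c₀ ≤ c → C₁-loop K q₁ q₂ f c₀ ≤ c
C₁-loop-≤ K ≁ zero c₀≤c = c₀≤c
C₁-loop-≤ K {q₁} {q₂} ≁ (suc f) {c₀} c₀≤c with simᵇ K c₀ q₁ q₂ in sim
... | false = c₀≤c
... | true  = C₁-loop-≤ K ≁ f (≤∧≢⇒< c₀≤c λ { refl → ≁ (Equivalence.from T-≡ sim) })

≁⇒C₁≤ : ∀ {n m} (K : Kripke n m) {q₁ q₂ c} → ¬ K ⊢ q₁ ∼[ c ] q₂ → C₁ K q₁ q₂ ≤ c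
≁⇒C₁≤ {n} K ≁ = C₁-loop-≤ K ≁ n z≤n

sizeBound : ℕ → ℕ → ℕ
sizeBound k zero    = 2
sizeBound k (suc c) = suc (k * suc (sizeBound k c))

suc-sizeBound-1 : ∀ c → suc (sizeBound 1 c) ≡ 2 * c + 3
suc-sizeBound-1 zero    = refl
suc-sizeBound-1 (suc c) = begin
  2 + 1 * suc (sizeBound 1 c)   ≡⟨ cong (2 +_) (*-identityˡ _) ⟩
  2 + suc (sizeBound 1 c)       ≡⟨ cong (2 +_) (suc-sizeBound-1 c) ⟩
  2 + (2 * c + 3)               ≡⟨ cong (_+ 3) (sym (*-suc 2 c)) ⟩
  2 * suc c + 3                 ∎
  where open ≡-Reasoning

3+sizeBound≤5*k^c : ∀ {k} → 2 ≤ k → ∀ c → 3 + sizeBound k c ≤ 5 * k ^ c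
3+sizeBound≤5*k^c     2≤k zero    = ≤-refl
3+sizeBound≤5*k^c {k} 2≤k (suc c) = begin
  4 + k * suc (sizeBound k c)       ≤⟨ +-monoˡ-≤ _ (*-monoˡ-≤ 2 2≤k) ⟩
  k * 2 + k * suc (sizeBound k c)   ≡⟨ sym (*-distribˡ-+ k 2 _) ⟩
  k * (3 + sizeBound k c)           ≤⟨ *-monoʳ-≤ k (3+sizeBound≤5*k^c 2≤k c) ⟩
  k * (5 * k ^ c)                   ≡⟨ *-left-comm k 5 (k ^ c) ⟩
  5 * (k * k ^ c)                   ∎
  where
  open ≤-Reasoning
  *-left-comm : ∀ x y z → x * (y * z) ≡ y * (x * z)
  *-left-comm = solve-∀

module BoundedDegree {n m} (K : Kripke n m) {k} (1≤k : 1 ≤ k) (∣δ∣≤k : ∀ q → ∣ δ K q ∣ ≤ k) where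

  2≤sizeBound : ∀ c → 2 ≤ sizeBound k c
  2≤sizeBound zero    = ≤-refl
  2≤sizeBound (suc c) = s≤s (*-mono-≤ 1≤k (s≤s z≤n))

  1≤sizeBound : ∀ c → 1 ≤ sizeBound k c
  1≤sizeBound c = ≤-trans (s≤s z≤n) (2≤sizeBound c)

  length-successors≤k : ∀ q → length (successors K q) ≤ k
  length-successors≤k q = subst (_≤ k) (sym (length-elems (δ K q))) (∣δ∣≤k q)

  treeSize-⋀-successors : ∀ {c} q (g : Fin n → Form m) →
    All (λ q' → treeSize (g q') ≤ sizeBound k c) (successors K q) →
    treeSize (⋀ (map g (successors K q))) < k * suc (sizeBound k c)
  treeSize-⋀-successors {c} q g bounded = <-≤-trans
    (treeSize-⋀-map g (successors K q) (0<length-elems (δ-nonemp K q)) (All.map s≤s bounded))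
    (*-monoˡ-≤ (suc (sizeBound k c)) (length-successors≤k q))

  treeSize-Dfuel : ∀ f {c} q₁ q₂ → C₁ K q₁ q₂ ≤ c → treeSize (Dfuel K f q₁ q₂) ≤ sizeBound k c
  treeSize-Dfuel zero {c} q₁ q₂ _ = 1≤sizeBound c
  treeSize-Dfuel (suc f) {c} q₁ q₂ C≤c with C₁ K q₁ q₂ | C≤c
  ... | zero | _ with minElem (lab K q₁ ─ lab K q₂)
  ...   | just _ = 1≤sizeBound c
  ...   | nothing with minElem (lab K q₂ ─ lab K q₁)
  ...     | just _  = 2≤sizeBound c
  ...     | nothing = 1≤sizeBound c
  treeSize-Dfuel (suc f) {suc c} q₁ q₂ _ | suc c' | s≤s c'≤c
    with findᵇ (λ q₁' → all (λ q₂' → not (simᵇ K c' q₁' q₂')) (successors K q₂)) (successors K q₁)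
         in found₁
  ... | just q₁' = m≤n⇒m≤1+n (treeSize-⋀-successors q₂ _
      (All.map bounded (findᵇ-all-just⇒All _ (successors K q₁) (successors K q₂) found₁)))
    where
    bounded : ∀ {q₂'} → T (not (simᵇ K c' q₁' q₂')) → treeSize (Dfuel K f q₁' q₂') ≤ sizeBound k c
    bounded ≁ = treeSize-Dfuel f q₁' _ (≤-trans (≁⇒C₁≤ K (T-not⇒¬T ≁)) c'≤c)
  ... | nothing
    with findᵇ (λ q₂' → all (λ q₁' → not (simᵇ K c' q₁' q₂')) (successors K q₁)) (successors K q₂)
         in found₂
  ...   | just q₂' = s≤s (treeSize-⋀-successors q₁ _
      (All.map bounded (findᵇ-all-just⇒All _ (successors K q₂) (successors K q₁) found₂)))
    where
    bounded : ∀ {q₁'} → T (not (simᵇ K c' q₁' q₂')) → treeSize (Dfuel K f q₂' q₁') ≤ sizeBound k c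
    bounded {q₁'} ≁ = treeSize-Dfuel f q₂' _
      (≤-trans (≁⇒C₁≤ K (T-not⇒¬T ≁ ∘ subst T (simᵇ-sym K c' q₂' q₁'))) c'≤c)
  ...   | nothing = 1≤sizeBound (suc c)

  treeSize-D : ∀ {c q₁ q₂} → ¬ K ⊢ q₁ ∼[ c ] q₂ → treeSize (D K q₁ q₂) ≤ sizeBound k c
  treeSize-D {q₁ = q₁} {q₂} ≁ = treeSize-Dfuel (suc (C₁ K q₁ q₂)) q₁ q₂ (≁⇒C₁≤ K ≁)

  treeSize-Sep : ∀ {S⁺ S⁻ c} → Nonempty S⁺ → Nonempty S⁻ → SepAt K S⁺ S⁻ c →
    treeSize (Sep K S⁺ S⁻) < length (elems S⁺) * (length (elems S⁻) * suc (sizeBound k c))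
  treeSize-Sep {S⁺} {S⁻} ne⁺ ne⁻ sep =
    treeSize-⋁-map _ (elems S⁺) (0<length-elems ne⁺) (All.map conjunction (elems⊆ S⁺))
    where
    conjunction : ∀ {p} → p ∈ S⁺ → treeSize (⋀ (map (D K p) (elems S⁻))) < _
    conjunction p∈S⁺ = treeSize-⋀-map _ (elems S⁻) (0<length-elems ne⁻)
      (All.map (λ q∈S⁻ → s≤s (treeSize-D (sep _ _ p∈S⁺ q∈S⁻))) (elems⊆ S⁻))

  size-Sep≤ : ∀ {S⁺ S⁻ c} → Nonempty S⁺ → Nonempty S⁻ → SepAt K S⁺ S⁻ c →
    size (Sep K S⁺ S⁻) ≤ suc (sizeBound k c) * ∣ S⁺ ∣ * ∣ S⁻ ∣
  size-Sep≤ {S⁺} {S⁻} {c} ne⁺ ne⁻ sep = begin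
    size (Sep K S⁺ S⁻)       ≤⟨ size≤treeSize (Sep K S⁺ S⁻) ⟩
    treeSize (Sep K S⁺ S⁻)   <⟨ treeSize-Sep ne⁺ ne⁻ sep ⟩
    length (elems S⁺) * (length (elems S⁻) * suc (sizeBound k c))
      ≡⟨ cong₂ (λ a b → a * (b * suc (sizeBound k c))) (length-elems S⁺) (length-elems S⁻) ⟩
    ∣ S⁺ ∣ * (∣ S⁻ ∣ * suc (sizeBound k c))
      ≡⟨ *-rearrange ∣ S⁺ ∣ ∣ S⁻ ∣ _ ⟩
    suc (sizeBound k c) * ∣ S⁺ ∣ * ∣ S⁻ ∣
      ∎
    where
    open ≤-Reasoning
    *-rearrange : ∀ a b x → a * (b * x) ≡ x * a * b
    *-rearrange = solve-∀

corollary1 : ∀ {n m} (K : Kripke n m) (k : ℕ) → degree K ≡ k →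
    (S⁺ S⁻ : Subset n) → IsSample K S⁺ S⁻ → Nonempty S⁺ → Nonempty S⁻ →
    (c : ℕ) → IsC K S⁺ S⁻ c →
    (2 ≤ k → size (Sep K S⁺ S⁻) ≤ (5 * k ^ c + 1) * ∣ S⁺ ∣ * ∣ S⁻ ∣) ×
    (k ≡ 1 → size (Sep K S⁺ S⁻) ≤ (2 * c + 3) * ∣ S⁺ ∣ * ∣ S⁻ ∣)
corollary1 K k degree≡k S⁺ S⁻ _ ne⁺ ne⁻ c (sep , _) = degree≥2 , degree≡1
  where
  ∣δ∣≤k : ∀ q → ∣ δ K q ∣ ≤ k
  ∣δ∣≤k q = subst (∣ δ K q ∣ ≤_) degree≡k (∣δ∣≤degree K q)

  size≤ : ∀ {X} → 1 ≤ k → suc (sizeBound k c) ≤ X → size (Sep K S⁺ S⁻) ≤ X * ∣ S⁺ ∣ * ∣ S⁻ ∣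
  size≤ 1≤k bound≤X = ≤-trans (BoundedDegree.size-Sep≤ K 1≤k ∣δ∣≤k {c = c} ne⁺ ne⁻ sep)
                          (*-monoˡ-≤ ∣ S⁻ ∣ (*-monoˡ-≤ ∣ S⁺ ∣ bound≤X))

  degree≥2 : 2 ≤ k → size (Sep K S⁺ S⁻) ≤ (5 * k ^ c + 1) * ∣ S⁺ ∣ * ∣ S⁻ ∣
  degree≥2 2≤k = size≤ (≤-trans (s≤s z≤n) 2≤k)
    (≤-trans (m≤n+m _ 2) (≤-trans (3+sizeBound≤5*k^c 2≤k c) (m≤m+n _ 1)))

  degree≡1 : k ≡ 1 → size (Sep K S⁺ S⁻) ≤ (2 * c + 3) * ∣ S⁺ ∣ * ∣ S⁻ ∣
  degree≡1 refl = size≤ ≤-refl (≤-reflexive (suc-sizeBound-1 c))
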